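{- Let $T_1,T_2$ be planar rooted trees with $n$ nodes. Then $T_1\leq_T T_2$ if and only if, for every node $k$, $u_{T_1}(k)\subseteq u_{T_2}(k)$.
   Context: Nodes of a planar (ordered) rooted tree are labelled by the preorder traversal (root first, then recursively the subtrees of its children from left to right), and nodes of different trees with the same number of nodes are identified via their labels. For a node $k$ of $T$, $u_T(k)$ denotes the set of (proper) descendants of $k$ in $T$. The Tamari order: $T_1\leq_T T_2$ iff $|u_{T_1}(k)|\leq|u_{T_2}(k)|$ for every node $k$. -}

module Defs where

open import Data.Nat using (ℕ; zero; suc; _+_; _≤_; _<_)
open import Data.Nat.Properties using (_≟_)
open import Data.List using (List; []; _∷_; _++_; length)
open import Data.List.Membership.Propositional using (_∈_)
open import Data.Product using (_×_; _,_)
open import Relation.Nullary using (yes; no)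

data Tree : Set where
  node : List Tree → Tree

mutual
  size : Tree → ℕ
  size (node cs) = suc (sizeF cs)

  sizeF : List Tree → ℕ
  sizeF []       = 0
  sizeF (t ∷ ts) = size t + sizeF ts

mutual
  labels : ℕ → Tree → List ℕ
  labels o (node cs) = o ∷ labelsF (suc o) cs

  labelsF : ℕ → List Tree → List ℕ
  labelsF o []       = []
  labelsF o (t ∷ ts) = labels o t ++ labelsF (o + size t) ts

mutual
  descs : ℕ → Tree → List (ℕ × List ℕ)
  descs o (node cs) = (o , labelsF (suc o) cs) ∷ descsF (suc o) cs

  descsF : ℕ → List Tree → List (ℕ × List ℕ)
  descsF o []       = []
  descsF o (t ∷ ts) = descs o t ++ descsF (o + size t) ts

lookupDesc : ℕ → List (ℕ × List ℕ) → List ℕ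
lookupDesc k []             = []
lookupDesc k ((l , d) ∷ ps) with k ≟ l
... | yes _ = d
... | no  _ = lookupDesc k ps

-- u T k : the (proper) descendants of node k of T, nodes labelled 1..n in preorder.
u : Tree → ℕ → List ℕ
u T k = lookupDesc k (descs 1 T)

_≤T_ : Tree → Tree → Set
T₁ ≤T T₂ = ∀ k → 1 ≤ k → k ≤ size T₁ → length (u T₁ k) ≤ length (u T₂ k)

module Submission where

open import Defs
open import Data.Nat using (ℕ; _≤_)
open import Data.List.Membership.Propositional using (_∈_)
open import Data.Product using (_×_)
open import Relation.Binary.PropositionalEquality using (_≡_)
open import Function.Bundles using (_⇔_)

open import Data.Nat using (zero; suc; _+_; _<_; z≤n; z<s)
open import Data.Nat.Properties
open import Data.List using (List; []; _∷_; _++_; length)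
open import Data.List.Relation.Unary.Any using (here; there)
open import Data.List.Relation.Unary.All using (All; []; _∷_)
open import Data.List.Relation.Unary.All.Properties using (++⁺)
open import Data.List.Relation.Binary.Subset.Propositional using (_⊆_)
open import Data.Product using (_,_; ∃)
open import Data.Sum using (inj₁; inj₂)
open import Relation.Binary.PropositionalEquality using (refl; sym; trans; cong; subst; subst₂)
open import Function.Bundles using (mk⇔; Equivalence)
open import Relation.Nullary using (yes; no; contradiction)

-- In preorder the descendants of node k are exactly the labels k+1, …, k+|u(k)|:
-- every descendant set is an interval starting right after its node.  Two
-- intervals with the same left end are nested iff their lengths compare, so
-- comparing the sizes of the u(k) is the same as comparing the sets.

interval : ℕ → ℕ → List ℕ
interval o zero    = []
interval o (suc m) = o ∷ interval (suc o) m

interval-++ : ∀ o a b → interval o (a + b) ≡ interval o a ++ interval (o + a) b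
interval-++ o zero    b rewrite +-identityʳ o = refl
interval-++ o (suc a) b rewrite interval-++ (suc o) a b | +-suc o a = refl

length-interval : ∀ o m → length (interval o m) ≡ m
length-interval o zero    = refl
length-interval o (suc m) = cong suc (length-interval (suc o) m)

∈-interval⁻ : ∀ {o m j} → j ∈ interval o m → o ≤ j × j < o + m
∈-interval⁻ {o} {suc m} (here refl) = ≤-refl , m<m+n o z<s
∈-interval⁻ {o} {suc m} {j} (there j∈) with ∈-interval⁻ j∈
... | o<j , j<1+o+m = <⇒≤ o<j , subst (j <_) (sym (+-suc o m)) j<1+o+m

∈-interval⁺ : ∀ {o m j} → o ≤ j → j < o + m → j ∈ interval o m
∈-interval⁺ {o} {zero} {j} o≤j j<o+0 = contradiction o≤j (<⇒≱ (subst (j <_) (+-identityʳ o) j<o+0))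
∈-interval⁺ {o} {suc m} {j} o≤j j<o+1+m with m≤n⇒m<n∨m≡n o≤j
... | inj₂ refl = here refl
... | inj₁ o<j  = there (∈-interval⁺ o<j (subst (j <_) (+-suc o m) j<o+1+m))

interval-⊆⇔≤ : ∀ o m m′ → (interval o m ⊆ interval o m′) ⇔ (m ≤ m′)
interval-⊆⇔≤ o m m′ = mk⇔ (⊆⇒≤ m) ≤⇒⊆
  where
  ⊆⇒≤ : ∀ m → interval o m ⊆ interval o m′ → m ≤ m′
  ⊆⇒≤ zero    _ = z≤n
  ⊆⇒≤ (suc p) sub with ∈-interval⁻ (sub (∈-interval⁺ (m≤m+n o p) (+-monoʳ-< o (n<1+n p))))
  ... | _ , o+p<o+m′ = +-cancelˡ-< o p m′ o+p<o+m′

  ≤⇒⊆ : m ≤ m′ → interval o m ⊆ interval o m′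
  ≤⇒⊆ m≤m′ j∈ with ∈-interval⁻ j∈
  ... | o≤j , j<o+m = ∈-interval⁺ o≤j (<-≤-trans j<o+m (+-monoʳ-≤ o m≤m′))

mutual
  labels-interval : ∀ o t → labels o t ≡ interval o (size t)
  labels-interval o (node cs) = cong (o ∷_) (labelsF-interval (suc o) cs)

  labelsF-interval : ∀ o cs → labelsF o cs ≡ interval o (sizeF cs)
  labelsF-interval o []       = refl
  labelsF-interval o (t ∷ ts)
    rewrite labels-interval o t | labelsF-interval (o + size t) ts =
    sym (interval-++ o (size t) (sizeF ts))

DescendantsInterval : ℕ × List ℕ → Set
DescendantsInterval (k , d) = ∃ λ m → d ≡ interval (suc k) m

mutual
  descs-intervals : ∀ o t → All DescendantsInterval (descs o t)
  descs-intervals o (node cs) =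
    (sizeF cs , labelsF-interval (suc o) cs) ∷ descsF-intervals (suc o) cs

  descsF-intervals : ∀ o cs → All DescendantsInterval (descsF o cs)
  descsF-intervals o []       = []
  descsF-intervals o (t ∷ ts) =
    ++⁺ (descs-intervals o t) (descsF-intervals (o + size t) ts)

lookupDesc-interval : ∀ k ps → All DescendantsInterval ps →
                      ∃ λ m → lookupDesc k ps ≡ interval (suc k) m
lookupDesc-interval k []             []         = 0 , refl
lookupDesc-interval k ((l , d) ∷ ps) (d≡ ∷ ps≡) with k ≟ l
... | yes refl = d≡
... | no  _    = lookupDesc-interval k ps ps≡

u-interval : ∀ T k → u T k ≡ interval (suc k) (length (u T k))
u-interval T k with lookupDesc-interval k (descs 1 T) (descs-intervals 1 T)
... | m , u≡ = trans u≡ (cong (interval (suc k)) (sym length-u))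
  where
  length-u : length (u T k) ≡ m
  length-u = trans (cong length u≡) (length-interval (suc k) m)

u-⊆⇔length-≤ : ∀ T₁ T₂ k → (u T₁ k ⊆ u T₂ k) ⇔ (length (u T₁ k) ≤ length (u T₂ k))
u-⊆⇔length-≤ T₁ T₂ k =
  subst₂ (λ xs ys → (xs ⊆ ys) ⇔ (length (u T₁ k) ≤ length (u T₂ k)))
    (sym (u-interval T₁ k)) (sym (u-interval T₂ k))
    (interval-⊆⇔≤ (suc k) (length (u T₁ k)) (length (u T₂ k)))

mainTheorem5 : (n : ℕ) (T₁ T₂ : Tree) → size T₁ ≡ n → size T₂ ≡ n →
    (T₁ ≤T T₂) ⇔ (∀ k → 1 ≤ k → k ≤ n → ∀ j → j ∈ u T₁ k → j ∈ u T₂ k)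
mainTheorem5 _ T₁ T₂ refl _ = mk⇔
  (λ T₁≤T₂ k 1≤k k≤n j → Equivalence.from (u-⊆⇔length-≤ T₁ T₂ k) (T₁≤T₂ k 1≤k k≤n) {j})
  (λ u⊆u k 1≤k k≤n → Equivalence.to (u-⊆⇔length-≤ T₁ T₂ k) (λ {j} → u⊆u k 1≤k k≤n j))
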